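{- Let $k,q\in\mathbb{N}$ and $\gamma,\delta>0$. If a $k$-hypergraph $G=(V,E)$ is a $(\gamma,\delta)$-small set hypergraph expander, then it is a $\left(\gamma,\delta\left(\frac{2}{\gamma}+1\right)\right)$-small partition hypergraph expander.
   Context: A $k$-hypergraph $G=(V,E)$ (with $|V|=n$, identified with $[n]=\{0,\ldots,n-1\}$) has a multiset $E$ of $k$-hyperedges, each a $k$-tuple of distinct vertices; $\Gamma(\mathbf{e})$ is the set of vertices appearing in $\mathbf{e}$. A hyperedge $\mathbf{e}$ lies on $S\subseteq V$ if $|\Gamma(\mathbf{e})\cap S|\ge2$. A vector $\mathbf{b}\in[q]^n$ is viewed as a partition of $V$ into blocks $\mathbf{b}^{ -1}(i)=\{j:b_j=i\}$, $i\in[q]$; a hyperedge congregates on $\mathbf{b}$ if it lies on some block $\mathbf{b}^{ -1}(i)$. $G$ is a $(\gamma,\delta)$-small set hypergraph expander (SSHE) if every $S\subseteq V$ with $|S|\le\gamma|V|$ has at most $\delta|E|$ hyperedges lying on it. $G$ is a $(\gamma,\delta)$-small partition hypergraph expander (SPHE) if for every $\mathbf{b}\in[q]^n$ all of whose blocks have size at most $\gamma|V|$, at most $\delta|E|$ hyperedges congregate on $\mathbf{b}$.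
   Formalization: The parameters γ and δ range over the positive rationals. -}

module Defs where

open import Data.Nat as ℕ using (ℕ; _≤?_)
open import Data.Integer using (+_)
open import Data.Rational as ℚ using (ℚ; _/_; 0ℚ; 1ℚ; _>_; >-nonZero)
open import Data.Fin using (Fin)
open import Data.Fin.Properties using (_≟_; any?)
open import Data.Fin.Subset using (Subset; _∩_; ∣_∣)
open import Data.Vec using (tabulate)
open import Data.List using (List; length; filter)
open import Data.List.Relation.Unary.All using (All)
open import Data.Product using (Σ; _×_)
open import Function.Definitions using (Injective)
open import Relation.Binary.PropositionalEquality using (_≡_)
open import Relation.Nullary using (does)

toℚ : ℕ → ℚ
toℚ m = + m / 1

Hyperedge : ℕ → ℕ → Set
Hyperedge n k = Fin k → Fin n

-- a k-hypergraph on V = [n]: a multiset (list) of k-tuples of distinct vertices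
record Hypergraph (n k : ℕ) : Set where
  field
    edges    : List (Hyperedge n k)
    distinct : All (λ e → Injective _≡_ _≡_ e) edges
open Hypergraph public

Γ : ∀ {n k} → Hyperedge n k → Subset n
Γ {n} {k} e = tabulate (λ v → does (any? (λ i → e i ≟ v)))

liesOn? : ∀ {n k} (S : Subset n) (e : Hyperedge n k) → _
liesOn? S e = 2 ≤? ∣ Γ e ∩ S ∣

#lyingOn : ∀ {n k} → Hypergraph n k → Subset n → ℕ
#lyingOn G S = length (filter (liesOn? S) (edges G))

block : ∀ {n q} → (Fin n → Fin q) → Fin q → Subset n
block b i = tabulate (λ v → does (b v ≟ i))

congregates? : ∀ {n k q} (b : Fin n → Fin q) (e : Hyperedge n k) → _
congregates? {q = q} b e = any? (λ i → liesOn? (block b i) e)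

#congregating : ∀ {n k q} → Hypergraph n k → (Fin n → Fin q) → ℕ
#congregating G b = length (filter (congregates? b) (edges G))

SSHE : ∀ {n k} → Hypergraph n k → ℚ → ℚ → Set
SSHE {n} G γ δ = (S : Subset n) → toℚ ∣ S ∣ ℚ.≤ γ ℚ.* toℚ n →
  toℚ (#lyingOn G S) ℚ.≤ δ ℚ.* toℚ (length (edges G))

SPHE : ∀ {n k} → ℕ → Hypergraph n k → ℚ → ℚ → Set
SPHE {n} q G γ δ = (b : Fin n → Fin q) →
  ((i : Fin q) → toℚ ∣ block b i ∣ ℚ.≤ γ ℚ.* toℚ n) →
  toℚ (#congregating G b) ℚ.≤ δ ℚ.* toℚ (length (edges G))

sphe-δ : (γ δ : ℚ) → γ > 0ℚ → ℚ
sphe-δ γ δ γ>0 = δ ℚ.* (ℚ._÷_ (toℚ 2) γ {{>-nonZero γ>0}} ℚ.+ 1ℚ)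

-- Merge the blocks of the partition greedily (next fit) into bins of at most
-- γn vertices.  A bin is closed only when the next block does not fit into it,
-- so a closed bin and the first block of the following bin have more than γn
-- vertices together; as every block is counted at most twice this way, m bins
-- satisfy (m - 1)γn ≤ 2n, i.e. m ≤ 2/γ + 1.  A hyperedge congregating on the
-- partition lies on the bin containing its block, and by the small set
-- expansion every bin carries at most δ|E| hyperedges.
module Submission where

open import Defs
open import Data.Bool using (true; false; if_then_else_)
open import Data.Fin using (Fin; zero; suc)
open import Data.Fin.Properties using (_≟_)
open import Data.Fin.Subset using (Subset; _∩_; _∪_; ∣_∣; _⊆_; ⊥; inside; outside)
open import Data.Fin.Subset.Properties
  using (p⊆q⇒∣p∣≤∣q∣; p∩q⊆p; p∩q⊆q; x∈p∩q⁺; p⊆p∪q; q⊆p∪q; ⊆-refl; ∣⊥∣≡0)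
open import Data.Integer as ℤ using (+_)
import Data.Integer.Properties as ℤP
import Data.Integer.Solver as ℤSolver
open import Data.List using (List; []; _∷_; length; map; filter; tabulate)
import Data.List.Properties as ListP
open import Data.List.Relation.Unary.All as All using (All; []; _∷_)
import Data.List.Relation.Unary.All.Properties as AllP
open import Data.List.Relation.Unary.Any as Any using (Any; here; there)
open import Data.Nat as ℕ using (ℕ; zero; suc; z≤n; s≤s)
import Data.Nat.Coprimality as Coprimality
open import Data.Nat.ListAction using (sum)
import Data.Nat.Properties as ℕP
import Data.Nat.Solver as ℕSolver
open import Data.Product using (Σ-syntax; _,_; proj₁; proj₂)
open import Data.Rational as ℚ using (ℚ; 0ℚ; 1ℚ; _>_)
import Data.Rational.Properties as ℚP
import Data.Rational.Solver as ℚSolver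
import Data.Rational.Unnormalised as ℚᵘ
import Data.Rational.Unnormalised.Properties as ℚᵘP
open import Data.Vec using ([]; _∷_)
open import Function using (id; _∘_)
open import Relation.Binary.PropositionalEquality
  using (_≡_; refl; sym; trans; cong; cong₂; subst; subst₂; module ≡-Reasoning)
open import Relation.Nullary using (Dec; does; yes; no)
open import Relation.Unary using (Decidable)

toℚᵘ-toℚ : ∀ m → ℚ.toℚᵘ (toℚ m) ≡ ℚᵘ.mkℚᵘ (+ m) 0
toℚᵘ-toℚ m
  rewrite ℚP.normalize-coprime (Coprimality.sym (Coprimality.1-coprimeTo m)) = refl

toℚ-+ : ∀ a b → toℚ (a ℕ.+ b) ≡ toℚ a ℚ.+ toℚ b
toℚ-+ a b = ℚP.toℚᵘ-injective
  (ℚᵘP.≃-trans unnormalised (ℚᵘP.≃-sym (ℚP.toℚᵘ-homo-+ (toℚ a) (toℚ b))))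
  where
  open ℤSolver.+-*-Solver
  unnormalised : ℚ.toℚᵘ (toℚ (a ℕ.+ b)) ℚᵘ.≃ ℚ.toℚᵘ (toℚ a) ℚᵘ.+ ℚ.toℚᵘ (toℚ b)
  unnormalised rewrite toℚᵘ-toℚ (a ℕ.+ b) | toℚᵘ-toℚ a | toℚᵘ-toℚ b =
    ℚᵘ.*≡* (trans (cong (ℤ._* + 1) (ℤP.pos-+ a b))
      (solve 2 (λ x y → (x :+ y) :* con (+ 1)
                      := (x :* con (+ 1) :+ y :* con (+ 1)) :* con (+ 1))
             refl (+ a) (+ b)))

toℚ-mono-≤ : ∀ {a b} → a ℕ.≤ b → toℚ a ℚ.≤ toℚ b
toℚ-mono-≤ {a} {b} a≤b = ℚP.toℚᵘ-cancel-≤ unnormalised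
  where
  unnormalised : ℚ.toℚᵘ (toℚ a) ℚᵘ.≤ ℚ.toℚᵘ (toℚ b)
  unnormalised rewrite toℚᵘ-toℚ a | toℚᵘ-toℚ b = ℚᵘ.*≤*
    (subst₂ ℤ._≤_ (sym (ℤP.*-identityʳ (+ a))) (sym (ℤP.*-identityʳ (+ b))) (ℤ.+≤+ a≤b))

toℚ-nonNeg : ∀ m → ℚ.NonNegative (toℚ m)
toℚ-nonNeg m = ℚ.nonNegative (toℚ-mono-≤ {0} {m} z≤n)

toℚ-suc-pos : ∀ m → ℚ.Positive (toℚ (suc m))
toℚ-suc-pos m = ℚ.positive (ℚP.<-≤-trans (ℚP.positive⁻¹ 1ℚ) (toℚ-mono-≤ {1} {suc m} (s≤s z≤n)))

toℚ-suc-* : ∀ m p → toℚ (suc m) ℚ.* p ≡ toℚ m ℚ.* p ℚ.+ p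
toℚ-suc-* m p = trans (cong (ℚ._* p) (toℚ-+ 1 m))
  (solve 2 (λ x p → (con 1ℚ :+ x) :* p := x :* p :+ p) refl (toℚ m) p)
  where open ℚSolver.+-*-Solver

toℚ-* : ∀ a b → toℚ (a ℕ.* b) ≡ toℚ a ℚ.* toℚ b
toℚ-* zero    b = sym (ℚP.*-zeroˡ (toℚ b))
toℚ-* (suc a) b = begin
  toℚ (b ℕ.+ a ℕ.* b)            ≡⟨ toℚ-+ b (a ℕ.* b) ⟩
  toℚ b ℚ.+ toℚ (a ℕ.* b)        ≡⟨ cong (toℚ b ℚ.+_) (toℚ-* a b) ⟩
  toℚ b ℚ.+ toℚ a ℚ.* toℚ b      ≡⟨ ℚP.+-comm (toℚ b) _ ⟩
  toℚ a ℚ.* toℚ b ℚ.+ toℚ b      ≡⟨ toℚ-suc-* a (toℚ b) ⟨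
  toℚ (suc a) ℚ.* toℚ b          ∎
  where open ≡-Reasoning

toℚ-sum-≤-length-* : ∀ {A : Set} (f : A → ℕ) {c : ℚ} {xs : List A} →
  All (λ x → toℚ (f x) ℚ.≤ c) xs → toℚ (sum (map f xs)) ℚ.≤ toℚ (length xs) ℚ.* c
toℚ-sum-≤-length-* f {c} [] = ℚP.≤-reflexive (sym (ℚP.*-zeroˡ c))
toℚ-sum-≤-length-* f {c} {x ∷ xs} (fx≤c ∷ fxs≤c) = begin
  toℚ (f x ℕ.+ sum (map f xs))            ≡⟨ toℚ-+ (f x) _ ⟩
  toℚ (f x) ℚ.+ toℚ (sum (map f xs))      ≤⟨ ℚP.+-mono-≤ fx≤c (toℚ-sum-≤-length-* f fxs≤c) ⟩
  c ℚ.+ toℚ (length xs) ℚ.* c             ≡⟨ ℚP.+-comm c _ ⟩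
  toℚ (length xs) ℚ.* c ℚ.+ c             ≡⟨ toℚ-suc-* (length xs) c ⟨
  toℚ (suc (length xs)) ℚ.* c             ∎
  where open ℚP.≤-Reasoning

sum-map-mono-≤ : ∀ {A : Set} {f g : A → ℕ} → (∀ x → f x ℕ.≤ g x) →
  ∀ xs → sum (map f xs) ℕ.≤ sum (map g xs)
sum-map-mono-≤ f≤g []       = z≤n
sum-map-mono-≤ f≤g (x ∷ xs) = ℕP.+-mono-≤ (f≤g x) (sum-map-mono-≤ f≤g xs)

sum-map-mono-< : ∀ {A : Set} {f g : A → ℕ} → (∀ x → f x ℕ.≤ g x) →
  ∀ {xs} → Any (λ x → f x ℕ.< g x) xs → sum (map f xs) ℕ.< sum (map g xs)
sum-map-mono-< f≤g {x ∷ xs} (here fx<gx) = ℕP.+-mono-<-≤ fx<gx (sum-map-mono-≤ f≤g xs)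
sum-map-mono-< f≤g {x ∷ xs} (there any)  = ℕP.+-mono-≤-< (f≤g x) (sum-map-mono-< f≤g any)

module _ {A : Set} {P : A → Set} (P? : Decidable P) where

  length-filter-≤-∷ : ∀ x xs → length (filter P? xs) ℕ.≤ length (filter P? (x ∷ xs))
  length-filter-≤-∷ x xs with does (P? x)
  ... | true  = ℕP.n≤1+n _
  ... | false = ℕP.≤-refl

  length-filter-<-∷ : ∀ {x} xs → P x → length (filter P? xs) ℕ.< length (filter P? (x ∷ xs))
  length-filter-<-∷ xs px rewrite ListP.filter-accept P? {xs = xs} px = ℕP.≤-refl

length-filter-≤-sum : ∀ {A I : Set} {P : A → Set} (P? : Decidable P)
  {Q : I → A → Set} (Q? : ∀ i → Decidable (Q i)) (is : List I) →
  (∀ {x} → P x → Any (λ i → Q i x) is) →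
  ∀ xs → length (filter P? xs) ℕ.≤ sum (map (λ i → length (filter (Q? i) xs)) is)
length-filter-≤-sum P? Q? is P⇒Q []       = z≤n
length-filter-≤-sum P? Q? is P⇒Q (x ∷ xs) with P? x
... | yes px =
  ℕP.≤-trans (s≤s (length-filter-≤-sum P? Q? is P⇒Q xs))
    (sum-map-mono-< (λ i → length-filter-≤-∷ (Q? i) x xs)
      (Any.map (length-filter-<-∷ (Q? _) xs) (P⇒Q px)))
... | no ¬px =
  ℕP.≤-trans (length-filter-≤-sum P? Q? is P⇒Q xs)
    (sum-map-mono-≤ (λ i → length-filter-≤-∷ (Q? i) x xs) is)

∣p∪q∣≤∣p∣+∣q∣ : ∀ {n} (p q : Subset n) → ∣ p ∪ q ∣ ℕ.≤ ∣ p ∣ ℕ.+ ∣ q ∣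
∣p∪q∣≤∣p∣+∣q∣ []            []            = z≤n
∣p∪q∣≤∣p∣+∣q∣ (inside  ∷ p) (inside  ∷ q) =
  s≤s (ℕP.≤-trans (ℕP.m≤n⇒m≤1+n (∣p∪q∣≤∣p∣+∣q∣ p q)) (ℕP.≤-reflexive (sym (ℕP.+-suc ∣ p ∣ ∣ q ∣))))
∣p∪q∣≤∣p∣+∣q∣ (inside  ∷ p) (outside ∷ q) = s≤s (∣p∪q∣≤∣p∣+∣q∣ p q)
∣p∪q∣≤∣p∣+∣q∣ (outside ∷ p) (inside  ∷ q) =
  ℕP.≤-trans (s≤s (∣p∪q∣≤∣p∣+∣q∣ p q)) (ℕP.≤-reflexive (sym (ℕP.+-suc ∣ p ∣ ∣ q ∣)))
∣p∪q∣≤∣p∣+∣q∣ (outside ∷ p) (outside ∷ q) = ∣p∪q∣≤∣p∣+∣q∣ p q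

∣p∩q∣-monoʳ : ∀ {n} (p : Subset n) {q r : Subset n} → q ⊆ r → ∣ p ∩ q ∣ ℕ.≤ ∣ p ∩ r ∣
∣p∩q∣-monoʳ p {q} q⊆r = p⊆q⇒∣p∣≤∣q∣ (λ x∈p∩q → x∈p∩q⁺ (p∩q⊆p p q x∈p∩q , q⊆r (p∩q⊆q p q x∈p∩q)))

∣x∷p∣ : ∀ {n} x (p : Subset n) → ∣ x ∷ p ∣ ≡ (if x then suc else id) ∣ p ∣
∣x∷p∣ inside  p = refl
∣x∷p∣ outside p = refl

sum-tabulate-zero : ∀ q → sum (tabulate {n = q} (λ _ → 0)) ≡ 0
sum-tabulate-zero zero    = refl
sum-tabulate-zero (suc q) = sum-tabulate-zero q

sum-tabulate-sucAt : ∀ {q} (j : Fin q) (f : Fin q → ℕ) →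
  sum (tabulate (λ i → (if does (j ≟ i) then suc else id) (f i))) ≡ suc (sum (tabulate f))
sum-tabulate-sucAt zero    f = refl
sum-tabulate-sucAt (suc j) f = trans (cong (f zero ℕ.+_) (sum-tabulate-sucAt j (f ∘ suc)))
                                     (ℕP.+-suc (f zero) _)

-- Each vertex lies in exactly one block.
sum-∣block∣ : ∀ {n q} (b : Fin n → Fin q) → sum (map ∣_∣ (tabulate (block b))) ≡ n
sum-∣block∣ {n} {q} b = trans (cong sum (ListP.map-tabulate (block b) ∣_∣)) (count n b)
  where
  count : ∀ n (b : Fin n → Fin q) → sum (tabulate (∣_∣ ∘ block b)) ≡ n
  count zero    b = sum-tabulate-zero q
  count (suc n) b = begin
    sum (tabulate (∣_∣ ∘ block b))
      ≡⟨ cong sum (ListP.tabulate-cong (λ i → ∣x∷p∣ (does (b zero ≟ i)) (block (b ∘ suc) i))) ⟩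
    sum (tabulate (λ i → (if does (b zero ≟ i) then suc else id) ∣ block (b ∘ suc) i ∣))
      ≡⟨ sum-tabulate-sucAt (b zero) (∣_∣ ∘ block (b ∘ suc)) ⟩
    suc (sum (tabulate (∣_∣ ∘ block (b ∘ suc))))
      ≡⟨ cong suc (count n (b ∘ suc)) ⟩
    suc n ∎
    where open ≡-Reasoning

module NextFit {n : ℕ} (L : ℚ) where

  Fits : Subset n → Set
  Fits S = toℚ ∣ S ∣ ℚ.≤ L

  total : List (Subset n) → ℕ
  total Bs = sum (map ∣_∣ Bs)

  record Packing (Bs : List (Subset n)) : Set where
    field
      bins     : List (Subset n)
      bins-fit : All Fits bins
      covers   : All (λ B → Any (B ⊆_) bins) Bs

  open Packing

  bound-single : ∀ c → toℚ 1 ℚ.* L ℚ.≤ toℚ (c ℕ.+ 2 ℕ.* 0) ℚ.+ L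
  bound-single c = begin
    toℚ 1 ℚ.* L              ≡⟨ ℚP.*-identityˡ L ⟩
    L                        ≡⟨ ℚP.+-identityˡ L ⟨
    0ℚ ℚ.+ L                 ≤⟨ ℚP.+-monoˡ-≤ L (toℚ-mono-≤ {0} {c ℕ.+ 0} z≤n) ⟩
    toℚ (c ℕ.+ 0) ℚ.+ L      ∎
    where open ℚP.≤-Reasoning

  bound-merge : ∀ m c b u t → u ℕ.≤ c ℕ.+ b →
    toℚ m ℚ.* L ℚ.≤ toℚ (u ℕ.+ 2 ℕ.* t) ℚ.+ L →
    toℚ m ℚ.* L ℚ.≤ toℚ (c ℕ.+ 2 ℕ.* (b ℕ.+ t)) ℚ.+ L
  bound-merge m c b u t u≤c+b bound =
    ℚP.≤-trans bound (ℚP.+-monoˡ-≤ L (toℚ-mono-≤ {u ℕ.+ 2 ℕ.* t} {c ℕ.+ 2 ℕ.* (b ℕ.+ t)} weights))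
    where
    open ℕSolver.+-*-Solver
    weights : u ℕ.+ 2 ℕ.* t ℕ.≤ c ℕ.+ 2 ℕ.* (b ℕ.+ t)
    weights = ℕP.≤-trans (ℕP.+-monoˡ-≤ (2 ℕ.* t) u≤c+b) (ℕP.≤-trans (ℕP.m≤m+n _ b)
      (ℕP.≤-reflexive (solve 3 (λ c b t → c :+ b :+ con 2 :* t :+ b := c :+ con 2 :* (b :+ t))
                               refl c b t)))

  -- The overflow c + b > L of the closed bin pays for the new bin.
  bound-close : ∀ m c b t → L ℚ.< toℚ (c ℕ.+ b) →
    toℚ m ℚ.* L ℚ.≤ toℚ (b ℕ.+ 2 ℕ.* t) ℚ.+ L →
    toℚ (suc m) ℚ.* L ℚ.≤ toℚ (c ℕ.+ 2 ℕ.* (b ℕ.+ t)) ℚ.+ L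
  bound-close m c b t L<c+b bound = begin
    toℚ (suc m) ℚ.* L                          ≡⟨ toℚ-suc-* m L ⟩
    toℚ m ℚ.* L ℚ.+ L                          ≤⟨ ℚP.+-monoˡ-≤ L bound ⟩
    toℚ w ℚ.+ L ℚ.+ L                          ≤⟨ ℚP.+-monoˡ-≤ L (ℚP.+-monoʳ-≤ (toℚ w) (ℚP.<⇒≤ L<c+b)) ⟩
    toℚ w ℚ.+ toℚ (c ℕ.+ b) ℚ.+ L              ≡⟨ cong (ℚ._+ L) (toℚ-+ w (c ℕ.+ b)) ⟨
    toℚ (w ℕ.+ (c ℕ.+ b)) ℚ.+ L                ≡⟨ cong (λ v → toℚ v ℚ.+ L) weights ⟩
    toℚ (c ℕ.+ 2 ℕ.* (b ℕ.+ t)) ℚ.+ L          ∎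
    where
    open ℚP.≤-Reasoning
    open ℕSolver.+-*-Solver
    w = b ℕ.+ 2 ℕ.* t
    weights : w ℕ.+ (c ℕ.+ b) ≡ c ℕ.+ 2 ℕ.* (b ℕ.+ t)
    weights = solve 3 (λ c b t → b :+ con 2 :* t :+ (c :+ b) := c :+ con 2 :* (b :+ t)) refl c b t

  -- C is the currently open bin.
  NextFitFrom : Subset n → List (Subset n) → Set
  NextFitFrom C Bs =
    Σ[ P ∈ Packing (C ∷ Bs) ] toℚ (length (bins P)) ℚ.* L ℚ.≤ toℚ (∣ C ∣ ℕ.+ 2 ℕ.* total Bs) ℚ.+ L

  merge : ∀ {C B Bs} → NextFitFrom (C ∪ B) Bs → NextFitFrom C (B ∷ Bs)
  merge {C} {B} {Bs} (P , bound) =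
    record { bins = bins P ; bins-fit = bins-fit P
           ; covers = Any.map (λ C∪B⊆S {x} x∈C → C∪B⊆S (p⊆p∪q B x∈C)) (All.head (covers P))
                    ∷ Any.map (λ C∪B⊆S {x} x∈B → C∪B⊆S (q⊆p∪q C B x∈B)) (All.head (covers P))
                    ∷ All.tail (covers P) } ,
    bound-merge (length (bins P)) (∣ C ∣) (∣ B ∣) (∣ C ∪ B ∣) (total Bs) (∣p∪q∣≤∣p∣+∣q∣ C B) bound

  close : ∀ {C B Bs} → Fits C → L ℚ.< toℚ ∣ C ∪ B ∣ → NextFitFrom B Bs → NextFitFrom C (B ∷ Bs)
  close {C} {B} {Bs} C-fits L<∣C∪B∣ (P , bound) =
    record { bins = C ∷ bins P ; bins-fit = C-fits ∷ bins-fit P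
           ; covers = here ⊆-refl ∷ there (All.head (covers P)) ∷ All.map there (All.tail (covers P)) } ,
    bound-close (length (bins P)) (∣ C ∣) (∣ B ∣) (total Bs)
      (ℚP.<-≤-trans L<∣C∪B∣ (toℚ-mono-≤ (∣p∪q∣≤∣p∣+∣q∣ C B))) bound

  nextFit : ∀ C Bs → Fits C → All Fits Bs → NextFitFrom C Bs
  nextFit C [] C-fits [] =
    record { bins = C ∷ [] ; bins-fit = C-fits ∷ [] ; covers = here ⊆-refl ∷ [] } ,
    bound-single ∣ C ∣
  nextFit C (B ∷ Bs) C-fits (B-fits ∷ Bs-fit) = step (toℚ ∣ C ∪ B ∣ ℚP.≤? L)
    where
    step : Dec (Fits (C ∪ B)) → NextFitFrom C (B ∷ Bs)
    step (yes C∪B-fits)     = merge (nextFit (C ∪ B) Bs C∪B-fits Bs-fit)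
    step (no C∪B-overflows) = close C-fits (ℚP.≰⇒> C∪B-overflows) (nextFit B Bs B-fits Bs-fit)

  nextFitPacking : 0ℚ ℚ.≤ L → ∀ Bs → All Fits Bs →
    Σ[ P ∈ Packing Bs ] toℚ (length (bins P)) ℚ.* L ℚ.≤ toℚ (2 ℕ.* total Bs) ℚ.+ L
  nextFitPacking 0≤L Bs Bs-fit = drop-⊥ (nextFit ⊥ Bs ⊥-fits Bs-fit)
    where
    ⊥-fits : Fits ⊥
    ⊥-fits = subst (λ m → toℚ m ℚ.≤ L) (sym (∣⊥∣≡0 n)) 0≤L
    drop-⊥ : NextFitFrom ⊥ Bs →
      Σ[ P ∈ Packing Bs ] toℚ (length (bins P)) ℚ.* L ℚ.≤ toℚ (2 ℕ.* total Bs) ℚ.+ L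
    drop-⊥ (P , bound) =
      record { bins = bins P ; bins-fit = bins-fit P ; covers = All.tail (covers P) } ,
      subst (λ w → toℚ (length (bins P)) ℚ.* L ℚ.≤ toℚ w ℚ.+ L)
            (cong (ℕ._+ 2 ℕ.* total Bs) (∣⊥∣≡0 n)) bound

liesOn-mono : ∀ {n k} (e : Hyperedge n k) {S T : Subset n} → S ⊆ T →
  2 ℕ.≤ ∣ Γ e ∩ S ∣ → 2 ℕ.≤ ∣ Γ e ∩ T ∣
liesOn-mono e S⊆T lies = ℕP.≤-trans lies (∣p∩q∣-monoʳ (Γ e) S⊆T)

#congregating-≤-sum-#lyingOn : ∀ {n k q} (G : Hypergraph n k) (b : Fin n → Fin q)
  (Ss : List (Subset n)) → (∀ i → Any (block b i ⊆_) Ss) →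
  #congregating G b ℕ.≤ sum (map (#lyingOn G) Ss)
#congregating-≤-sum-#lyingOn G b Ss blocks-covered =
  length-filter-≤-sum (congregates? b) liesOn? Ss
    (λ { {e} (i , lies) → Any.map (λ {S} (B⊆S : block b i ⊆ S) → liesOn-mono e B⊆S lies) (blocks-covered i) })
    (edges G)

#congregating-empty : ∀ {k q} (G : Hypergraph 0 k) (b : Fin 0 → Fin q) → #congregating G b ≡ 0
#congregating-empty G b =
  cong length (ListP.filter-none (congregates? b) (All.universal (λ { _ (_ , ()) }) (edges G)))

[r÷p+1]*p≡r+p : ∀ r p .{{_ : ℚ.NonZero p}} → (r ℚ.÷ p ℚ.+ 1ℚ) ℚ.* p ≡ r ℚ.+ p
[r÷p+1]*p≡r+p r p = begin
  (r ℚ.* ℚ.1/ p ℚ.+ 1ℚ) ℚ.* p          ≡⟨ ℚP.*-distribʳ-+ p (r ℚ.* ℚ.1/ p) 1ℚ ⟩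
  r ℚ.* ℚ.1/ p ℚ.* p ℚ.+ 1ℚ ℚ.* p      ≡⟨ cong₂ ℚ._+_ (ℚP.*-assoc r (ℚ.1/ p) p) (ℚP.*-identityˡ p) ⟩
  r ℚ.* (ℚ.1/ p ℚ.* p) ℚ.+ p           ≡⟨ cong (λ y → r ℚ.* y ℚ.+ p) (ℚP.*-inverseˡ p) ⟩
  r ℚ.* 1ℚ ℚ.+ p                       ≡⟨ cong (ℚ._+ p) (ℚP.*-identityʳ r) ⟩
  r ℚ.+ p                              ∎
  where open ≡-Reasoning

x≤2÷γ+1 : ∀ γ .{{_ : ℚ.Positive γ}} N .{{_ : ℚ.Positive N}} x →
  x ℚ.* (γ ℚ.* N) ℚ.≤ toℚ 2 ℚ.* N ℚ.+ γ ℚ.* N →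
  x ℚ.≤ ℚ._÷_ (toℚ 2) γ {{ℚP.pos⇒nonZero γ}} ℚ.+ 1ℚ
x≤2÷γ+1 γ N x bound = ℚP.*-cancelʳ-≤-pos γ (begin
  x ℚ.* γ       ≤⟨ ℚP.*-cancelʳ-≤-pos N (subst₂ ℚ._≤_ (sym (ℚP.*-assoc x γ N))
                                          (sym (ℚP.*-distribʳ-+ N (toℚ 2) γ)) bound) ⟩
  toℚ 2 ℚ.+ γ   ≡⟨ [r÷p+1]*p≡r+p (toℚ 2) γ {{ℚP.pos⇒nonZero γ}} ⟨
  (ℚ._÷_ (toℚ 2) γ {{ℚP.pos⇒nonZero γ}} ℚ.+ 1ℚ) ℚ.* γ ∎)
  where open ℚP.≤-Reasoning

sphe-δ-pos : ∀ γ δ (γ>0 : γ > 0ℚ) → δ > 0ℚ → ℚ.Positive (sphe-δ γ δ γ>0)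
sphe-δ-pos γ δ γ>0 δ>0 =
  ℚP.pos*pos⇒pos δ {{ℚ.positive δ>0}} (2÷γ ℚ.+ 1ℚ)
    {{ℚP.pos+pos⇒pos 2÷γ {{ℚP.pos*pos⇒pos (toℚ 2) 1/γ {{ℚP.1/pos⇒pos γ {{ℚ.positive γ>0}}}}}} 1ℚ}}
  where
  1/γ = ℚ.1/_ γ {{ℚ.>-nonZero γ>0}}
  2÷γ = toℚ 2 ℚ.* 1/γ

lemma4p7 : (k q n : ℕ) (γ δ : ℚ) (γ>0 : γ > 0ℚ) (δ>0 : δ > 0ℚ)
    (G : Hypergraph n k) →
    SSHE G γ δ → SPHE q G γ (sphe-δ γ δ γ>0)
lemma4p7 k q zero γ δ γ>0 δ>0 G _ b _ =
  subst (λ m → toℚ m ℚ.≤ bound) (sym (#congregating-empty G b)) (ℚP.nonNegative⁻¹ bound)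
  where
  bound = sphe-δ γ δ γ>0 ℚ.* toℚ (length (edges G))
  instance
    bound-nonNeg : ℚ.NonNegative bound
    bound-nonNeg = ℚP.nonNeg*nonNeg⇒nonNeg (sphe-δ γ δ γ>0)
      {{ℚP.pos⇒nonNeg (sphe-δ γ δ γ>0) {{sphe-δ-pos γ δ γ>0 δ>0}}}}
      (toℚ (length (edges G))) {{toℚ-nonNeg (length (edges G))}}
lemma4p7 k q n@(suc n-1) γ δ γ>0 δ>0 G sshe b blocks-fit = begin
  toℚ (#congregating G b)
    ≤⟨ toℚ-mono-≤ (#congregating-≤-sum-#lyingOn G b (bins P) (AllP.tabulate⁻ (covers P))) ⟩
  toℚ (sum (map (#lyingOn G) (bins P)))
    ≤⟨ toℚ-sum-≤-length-* (#lyingOn G) (All.map (λ {S} → sshe S) (bins-fit P)) ⟩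
  toℚ (length (bins P)) ℚ.* (δ ℚ.* E)
    ≤⟨ ℚP.*-monoʳ-≤-nonNeg (δ ℚ.* E) (x≤2÷γ+1 γ N (toℚ (length (bins P))) bins-bound) ⟩
  X ℚ.* (δ ℚ.* E)
    ≡⟨ solve 3 (λ X δ E → X :* (δ :* E) := δ :* X :* E) refl X δ E ⟩
  δ ℚ.* X ℚ.* E ∎
  where
  open ℚP.≤-Reasoning
  open ℚSolver.+-*-Solver
  N = toℚ n
  E = toℚ (length (edges G))
  instance
    γ-pos : ℚ.Positive γ
    γ-pos = ℚ.positive γ>0
    N-pos : ℚ.Positive N
    N-pos = toℚ-suc-pos n-1
    δE-nonNeg : ℚ.NonNegative (δ ℚ.* E)
    δE-nonNeg = ℚP.nonNeg*nonNeg⇒nonNeg δ {{ℚP.pos⇒nonNeg δ {{ℚ.positive δ>0}}}} E {{toℚ-nonNeg (length (edges G))}}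
  X = ℚ._÷_ (toℚ 2) γ {{ℚP.pos⇒nonZero γ}} ℚ.+ 1ℚ
  open NextFit (γ ℚ.* N)
  open Packing
  γN-nonNeg : 0ℚ ℚ.≤ γ ℚ.* N
  γN-nonNeg = ℚP.nonNegative⁻¹ (γ ℚ.* N) {{ℚP.pos⇒nonNeg (γ ℚ.* N) {{ℚP.pos*pos⇒pos γ N}}}}
  packed = nextFitPacking γN-nonNeg (tabulate (block b)) (AllP.tabulate⁺ blocks-fit)
  P = proj₁ packed
  bins-bound : toℚ (length (bins P)) ℚ.* (γ ℚ.* N) ℚ.≤ toℚ 2 ℚ.* N ℚ.+ γ ℚ.* N
  bins-bound = subst (λ x → toℚ (length (bins P)) ℚ.* (γ ℚ.* N) ℚ.≤ x ℚ.+ γ ℚ.* N)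
                     (trans (cong (λ t → toℚ (2 ℕ.* t)) (sum-∣block∣ b)) (toℚ-* 2 n))
                     (proj₂ packed)
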